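{- Let $X$ be a finite alphabet with $|X|=N$, and let each symbol $x\in X$ act on the state space $\{0,1\}$ by a map $T_x\colon\{0,1\}\to\{0,1\}$ that is either the constant map $1$ (class GEN), the identity (class PROP), or the constant map $0$ (class KILL). Let $g,t,k$ be the numbers of GEN, PROP, KILL symbols ($g+t+k=N$) and put $\mathfrak{d}=gt$. Let $a(L)$ be the number of cascade-free sequences in $X^L$. Then \[a(L)=N\,a(L-1)-\mathfrak{d}\,a(L-2)\quad (L\ge 2),\qquad a(0)=1,\ a(1)=N.\] Case 1: if $N^2>4\mathfrak{d}$, then with $\lambda_{1,2}=\bigl(N\pm\sqrt{N^2-4\mathfrak{d}}\bigr)/2$ we have $a(L)=(\lambda_1^{L+1}-\lambda_2^{L+1})/(\lambda_1-\lambda_2)$. Case 2: $N^2=4\mathfrak{d}$ holds if and only if $k=0$ and $g=t=N/2$; in that case $a(L)=(L+1)(N/2)^L$.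
   Context: For a sequence $x_1,\dots,x_L\in X^L$, its state trajectory is $\sigma_0=0$, $\sigma_j=T_{x_j}(\sigma_{j-1})$ for $1\le j\le L$. The sequence is called cascade-free if there is no position $j$ with $x_j$ a PROP symbol and $\sigma_{j-1}=1$ (i.e. no PROP symbol ever receives state $1$). -}

module Defs where

open import Data.Nat using (ℕ; zero; suc)
open import Data.Fin using (Fin; inject₁) renaming (zero to fzero; suc to fsuc)
open import Data.Fin.Properties using (all?) renaming (_≟_ to _≟F_)
open import Data.Vec using (Vec; []; _∷_; lookup)
open import Data.List using (List; []; _∷_; map; concatMap; filter; length; allFin)
open import Relation.Binary.PropositionalEquality using (_≡_; refl)
open import Level using (0ℓ)
open import Algebra.Bundles using (CommutativeRing)
import Algebra.Properties.Semiring.Exp as Exp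
import Algebra.Properties.Semiring.Mult as Mult
open import Relation.Nullary using (Dec; yes; no; ¬_; ¬?; _→-dec_)

data Cls : Set where
  GEN PROP KILL : Cls

_≟C_ : (a b : Cls) → Dec (a ≡ b)
GEN  ≟C GEN  = yes refl
GEN  ≟C PROP = no (λ ())
GEN  ≟C KILL = no (λ ())
PROP ≟C GEN  = no (λ ())
PROP ≟C PROP = yes refl
PROP ≟C KILL = no (λ ())
KILL ≟C GEN  = no (λ ())
KILL ≟C PROP = no (λ ())
KILL ≟C KILL = yes refl

State : Set
State = Fin 2

zeroS oneS : State
zeroS = fzero
oneS  = fsuc fzero

Tcls : Cls → State → State
Tcls GEN  _ = oneS
Tcls PROP s = s
Tcls KILL _ = zeroS

module _ {N : ℕ} (cls : Fin N → Cls) where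

  T : Fin N → State → State
  T x = Tcls (cls x)

  traj : ∀ {L} → State → Vec (Fin N) L → Vec State (suc L)
  traj s []       = s ∷ []
  traj s (x ∷ xs) = s ∷ traj (T x s) xs

  σ : ∀ {L} → Vec (Fin N) L → Fin (suc L) → State
  σ xs j = lookup (traj zeroS xs) j

  -- Position j : Fin L stands for x_{j+1}; its incoming state is σ_j.
  -- Cascade-free: no PROP symbol ever receives state 1.
  CascadeFree : ∀ {L} → Vec (Fin N) L → Set
  CascadeFree xs = ∀ j → cls (lookup xs j) ≡ PROP → ¬ (σ xs (inject₁ j) ≡ oneS)

  cascadeFree? : ∀ {L} (xs : Vec (Fin N) L) → Dec (CascadeFree xs)
  cascadeFree? xs = all? (λ j → (cls (lookup xs j) ≟C PROP) →-dec ¬? (σ xs (inject₁ j) ≟F oneS))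

  allSeqs : (L : ℕ) → List (Vec (Fin N) L)
  allSeqs zero    = [] ∷ []
  allSeqs (suc L) = concatMap (λ x → map (x ∷_) (allSeqs L)) (allFin N)

  a : ℕ → ℕ
  a L = length (filter cascadeFree? (allSeqs L))

  count : Cls → ℕ
  count c = length (filter (λ x → cls x ≟C c) (allFin N))

-- Case 1 closed form, with the division by (λ₁ - λ₂) cleared:
-- for any commutative ring R and any λ₁ λ₂ ∈ R with λ₁ + λ₂ = N and λ₁ λ₂ = d
-- (i.e. λ₁, λ₂ are the two roots of x² - N x + d),
-- (λ₁ - λ₂) · A(L) = λ₁^(L+1) - λ₂^(L+1) for all L.
module _ (R : CommutativeRing 0ℓ 0ℓ) where
  open CommutativeRing R
  open Mult semiring using () renaming (_×_ to _·_)
  open Exp semiring using () renaming (_^_ to _^R_)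

  BinetForm : (N d : ℕ) (A : ℕ → ℕ) → Set
  BinetForm N d A =
    (λ₁ λ₂ : Carrier) →
    (λ₁ + λ₂) ≈ (N · 1#) → (λ₁ * λ₂) ≈ (d · 1#) →
    ∀ L → ((λ₁ - λ₂) * (A L · 1#)) ≈ ((λ₁ ^R suc L) - (λ₂ ^R suc L))

-- A word is cascade-free from state 0 exactly when its first symbol is allowed in the current
-- state (PROP is forbidden in state 1) and the rest is cascade-free from the next state.  So the
-- numbers u(L), v(L) of cascade-free words of length L read from state 0 resp. 1 satisfy
-- u(L+1) = g v(L) + (t+k) u(L) and v(L+1) = g v(L) + k u(L); eliminating v gives
-- a(L+2) + gt a(L) = N a(L+1).  A solution of this recurrence is determined by its first two
-- values.  Since λ₁, λ₂ are roots of x² - Nx + gt, both λ₁ a(L) + λ₂^(L+1) and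
-- λ₁^(L+1) + λ₂ a(L) solve it, and they agree at L = 0, 1; subtracting gives Binet's formula.
-- When N² = 4gt, the double root N/2 makes (L+1)(N/2)^L a solution.  Finally
-- (g+t+k)² - 4gt = (g-t)² + k(2g+2t+k), so N² = 4gt exactly when k = 0 and g = t.
module Submission where

open import Defs
open import Data.Fin using (Fin; inject₁) renaming (zero to fzero; suc to fsuc)
open import Data.Integer using (+_) renaming (_+_ to _+ℤ_; _*_ to _*ℤ_; _-_ to _-ℤ_)
open import Data.Product using (_×_; _,_; proj₁; proj₂)
open import Level using (0ℓ)
open import Function.Bundles using (_⇔_; mk⇔; Equivalence)
open import Algebra.Bundles using (CommutativeSemiring; CommutativeRing)
open import Relation.Binary.PropositionalEquality using (_≡_; cong)
open import Data.Nat using (ℕ; zero; suc)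
import Data.Nat as ℕ
open import Data.Nat.Properties using (+-*-commutativeSemiring)
import Algebra.Properties.Group as GroupProperties
import Algebra.Properties.Ring as RingProperties
import Algebra.Properties.Semiring.Exp as Exp
import Algebra.Properties.Semiring.Mult as Mult
import Algebra.Solver.Ring.NaturalCoefficients.Default as NaturalCoefficientsSolver

module LinearRecurrence {c ℓ} (S : CommutativeSemiring c ℓ) where
  open CommutativeSemiring S
  open Exp semiring using (_^_)
  open import Algebra.Definitions _≈_ using (RightCancellative)
  open import Algebra.Properties.CommutativeSemigroup *-commutativeSemigroup using (x∙yz≈y∙xz)
  open NaturalCoefficientsSolver S using (solve; _:=_; _:+_; _:*_)
  open import Relation.Binary.Reasoning.Setoid setoid

  Recurrent : Carrier → Carrier → (ℕ → Carrier) → Set ℓ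
  Recurrent e₁ e₂ x = ∀ n → x (suc (suc n)) + e₂ * x n ≈ e₁ * x (suc n)

  recurrent-cong : ∀ {e₁ e₂ f₁ f₂ x y} → e₁ ≈ f₁ → e₂ ≈ f₂ → (∀ n → x n ≈ y n) →
                   Recurrent e₁ e₂ x → Recurrent f₁ f₂ y
  recurrent-cong {e₁} {e₂} {f₁} {f₂} {x} {y} e₁≈f₁ e₂≈f₂ x≈y rx n = begin
    y (suc (suc n)) + f₂ * y n ≈⟨ +-cong (x≈y (suc (suc n))) (*-cong e₂≈f₂ (x≈y n)) ⟨
    x (suc (suc n)) + e₂ * x n ≈⟨ rx n ⟩
    e₁ * x (suc n)             ≈⟨ *-cong e₁≈f₁ (x≈y (suc n)) ⟩
    f₁ * y (suc n)             ∎

  module _ {e₁ e₂ : Carrier} where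

    recurrent-+ : ∀ {x y} → Recurrent e₁ e₂ x → Recurrent e₁ e₂ y → Recurrent e₁ e₂ (λ n → x n + y n)
    recurrent-+ {x} {y} rx ry n = begin
      (x (suc (suc n)) + y (suc (suc n))) + e₂ * (x n + y n)
        ≈⟨ solve 5 (λ e x₂ y₂ x₀ y₀ → (x₂ :+ y₂) :+ e :* (x₀ :+ y₀)
                                    := (x₂ :+ e :* x₀) :+ (y₂ :+ e :* y₀))
                 refl e₂ (x (suc (suc n))) (y (suc (suc n))) (x n) (y n) ⟩
      (x (suc (suc n)) + e₂ * x n) + (y (suc (suc n)) + e₂ * y n) ≈⟨ +-cong (rx n) (ry n) ⟩
      e₁ * x (suc n) + e₁ * y (suc n)                                ≈⟨ distribˡ e₁ _ _ ⟨
      e₁ * (x (suc n) + y (suc n))                                   ∎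

    recurrent-*ˡ : ∀ a {x} → Recurrent e₁ e₂ x → Recurrent e₁ e₂ (λ n → a * x n)
    recurrent-*ˡ a {x} rx n = begin
      a * x (suc (suc n)) + e₂ * (a * x n)
        ≈⟨ solve 4 (λ a e x₂ x₀ → a :* x₂ :+ e :* (a :* x₀) := a :* (x₂ :+ e :* x₀))
                 refl a e₂ (x (suc (suc n))) (x n) ⟩
      a * (x (suc (suc n)) + e₂ * x n) ≈⟨ *-congˡ (rx n) ⟩
      a * (e₁ * x (suc n))             ≈⟨ x∙yz≈y∙xz a e₁ (x (suc n)) ⟩
      e₁ * (a * x (suc n))             ∎

    recurrent-^ : ∀ {r} → r * r + e₂ ≈ e₁ * r → Recurrent e₁ e₂ (r ^_)
    recurrent-^ {r} root n = begin
      r * (r * r ^ n) + e₂ * r ^ n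
        ≈⟨ solve 3 (λ r e p → r :* (r :* p) :+ e :* p := (r :* r :+ e) :* p) refl r e₂ (r ^ n) ⟩
      (r * r + e₂) * r ^ n ≈⟨ *-congʳ root ⟩
      (e₁ * r) * r ^ n     ≈⟨ *-assoc e₁ r (r ^ n) ⟩
      e₁ * (r * r ^ n)     ∎

    recurrent-unique : RightCancellative _+_ → ∀ {x y} → Recurrent e₁ e₂ x → Recurrent e₁ e₂ y →
                       x 0 ≈ y 0 → x 1 ≈ y 1 → ∀ n → x n ≈ y n
    recurrent-unique cancel {x} {y} rx ry x₀≈y₀ x₁≈y₁ n = proj₁ (agree n)
      where
      agree : ∀ n → x n ≈ y n × x (suc n) ≈ y (suc n)
      agree zero    = x₀≈y₀ , x₁≈y₁
      agree (suc n) with xₙ≈yₙ , xₙ₊₁≈yₙ₊₁ ← agree n = xₙ₊₁≈yₙ₊₁ , cancel (e₂ * x n) _ _ (begin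
        x (suc (suc n)) + e₂ * x n ≈⟨ rx n ⟩
        e₁ * x (suc n)             ≈⟨ *-congˡ xₙ₊₁≈yₙ₊₁ ⟩
        e₁ * y (suc n)             ≈⟨ ry n ⟨
        y (suc (suc n)) + e₂ * y n ≈⟨ +-congˡ (*-congˡ xₙ≈yₙ) ⟨
        y (suc (suc n)) + e₂ * x n ∎)

module ℕ-Recurrence = LinearRecurrence +-*-commutativeSemiring

module _ {c ℓ} (S : CommutativeSemiring c ℓ) where
  open CommutativeSemiring S
  open Mult semiring using (×-homo-+; ×1-homo-*) renaming (_×_ to _·_)
  open LinearRecurrence S using (Recurrent)
  open import Relation.Binary.Reasoning.Setoid setoid

  recurrent-·1 : ∀ {m n A} → ℕ-Recurrence.Recurrent m n A → Recurrent (m · 1#) (n · 1#) (λ i → A i · 1#)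
  recurrent-·1 {m} {n} {A} rec i = begin
    A (suc (suc i)) · 1# + (n · 1#) * (A i · 1#) ≈⟨ +-congˡ (×1-homo-* n (A i)) ⟨
    A (suc (suc i)) · 1# + (n ℕ.* A i) · 1#      ≈⟨ ×-homo-+ 1# (A (suc (suc i))) (n ℕ.* A i) ⟨
    (A (suc (suc i)) ℕ.+ n ℕ.* A i) · 1#         ≡⟨ cong (_· 1#) (rec i) ⟩
    (m ℕ.* A (suc i)) · 1#                       ≈⟨ ×1-homo-* m (A (suc i)) ⟩
    (m · 1#) * (A (suc i) · 1#)                  ∎

module _ (R : CommutativeRing 0ℓ 0ℓ) where
  open CommutativeRing R
  open Mult semiring using () renaming (_×_ to _·_)
  open Exp semiring using (_^_)
  open LinearRecurrence commutativeSemiring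
  open GroupProperties +-group using (∙-cancelʳ)
  open RingProperties ring using ([y-z]x≈yx-zx)
  open NaturalCoefficientsSolver commutativeSemiring using (solve; _:=_; _:+_; _:*_; con)
  open import Relation.Binary.Reasoning.Setoid setoid

  x+y≈z+w⇒x-w≈z-y : ∀ x y z w → x + y ≈ z + w → x - w ≈ z - y
  x+y≈z+w⇒x-w≈z-y x y z w eq = ∙-cancelʳ (y + w) _ _ (begin
    (x - w) + (y + w)  ≈⟨ solve 4 (λ x y w w⁻ → (x :+ w⁻) :+ (y :+ w) := (x :+ y) :+ (w :+ w⁻))
                                refl x y w (- w) ⟩
    (x + y) + (w - w)  ≈⟨ +-cong eq (-‿inverseʳ w) ⟩
    (z + w) + 0#       ≈⟨ +-congˡ (-‿inverseʳ y) ⟨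
    (z + w) + (y - y)  ≈⟨ solve 4 (λ z w y y⁻ → (z :+ w) :+ (y :+ y⁻) := (z :+ y⁻) :+ (y :+ w))
                                refl z w y (- y) ⟩
    (z - y) + (y + w)  ∎)

  binet : ∀ N d A → A 0 ≡ 1 → A 1 ≡ N → ℕ-Recurrence.Recurrent N d A → BinetForm R N d A
  binet N d A A₀ A₁ rec λ₁ λ₂ λ₁+λ₂≈N λ₁λ₂≈d L = begin
    (λ₁ - λ₂) * α L          ≈⟨ [y-z]x≈yx-zx (α L) λ₁ λ₂ ⟩
    λ₁ * α L - λ₂ * α L      ≈⟨ x+y≈z+w⇒x-w≈z-y _ _ _ _
                                  (recurrent-unique ∙-cancelʳ left right initial₀ initial₁ L) ⟩
    λ₁ ^ suc L - λ₂ ^ suc L  ∎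
    where
    α : ℕ → Carrier
    α n = A n · 1#

    α₀ : α 0 ≈ 1#
    α₀ = trans (reflexive (cong (_· 1#) A₀)) (+-identityʳ 1#)

    α₁ : α 1 ≈ λ₁ + λ₂
    α₁ = trans (reflexive (cong (_· 1#) A₁)) (sym λ₁+λ₂≈N)

    α-rec : Recurrent (λ₁ + λ₂) (λ₁ * λ₂) α
    α-rec = recurrent-cong (sym λ₁+λ₂≈N) (sym λ₁λ₂≈d) (λ _ → refl)
                           (recurrent-·1 commutativeSemiring {N} {d} {A} rec)

    root₁ : λ₁ * λ₁ + λ₁ * λ₂ ≈ (λ₁ + λ₂) * λ₁
    root₁ = solve 2 (λ a b → a :* a :+ a :* b := (a :+ b) :* a) refl λ₁ λ₂

    root₂ : λ₂ * λ₂ + λ₁ * λ₂ ≈ (λ₁ + λ₂) * λ₂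
    root₂ = solve 2 (λ a b → b :* b :+ a :* b := (a :+ b) :* b) refl λ₁ λ₂

    left : Recurrent (λ₁ + λ₂) (λ₁ * λ₂) (λ n → λ₁ * α n + λ₂ * λ₂ ^ n)
    left = recurrent-+ (recurrent-*ˡ λ₁ α-rec) (recurrent-*ˡ λ₂ (recurrent-^ root₂))

    right : Recurrent (λ₁ + λ₂) (λ₁ * λ₂) (λ n → λ₁ * λ₁ ^ n + λ₂ * α n)
    right = recurrent-+ (recurrent-*ˡ λ₁ (recurrent-^ root₁)) (recurrent-*ˡ λ₂ α-rec)

    initial₀ : λ₁ * α 0 + λ₂ * 1# ≈ λ₁ * 1# + λ₂ * α 0
    initial₀ = begin
      λ₁ * α 0 + λ₂ * 1#  ≈⟨ +-congʳ (*-congˡ α₀) ⟩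
      λ₁ * 1# + λ₂ * 1#   ≈⟨ +-congˡ (*-congˡ α₀) ⟨
      λ₁ * 1# + λ₂ * α 0  ∎

    initial₁ : λ₁ * α 1 + λ₂ * (λ₂ * 1#) ≈ λ₁ * (λ₁ * 1#) + λ₂ * α 1
    initial₁ = begin
      λ₁ * α 1 + λ₂ * (λ₂ * 1#)        ≈⟨ +-congʳ (*-congˡ α₁) ⟩
      λ₁ * (λ₁ + λ₂) + λ₂ * (λ₂ * 1#)  ≈⟨ solve 2 (λ a b → a :* (a :+ b) :+ b :* (b :* con 1)
                                                      := a :* (a :* con 1) :+ b :* (a :+ b))
                                                  refl λ₁ λ₂ ⟩
      λ₁ * (λ₁ * 1#) + λ₂ * (λ₁ + λ₂)  ≈⟨ +-congˡ (*-congˡ α₁) ⟨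
      λ₁ * (λ₁ * 1#) + λ₂ * α 1        ∎

-- ℕ's arithmetic is opened only here, so that the semiring operators above are unambiguous.
open import Data.Nat using (_+_; _*_; _^_; _/_; _>_; _≤_)
open import Relation.Binary.PropositionalEquality
  using (refl; sym; trans; cong₂; subst₂; module ≡-Reasoning)
open import Data.Bool using (true; false; if_then_else_)
open import Data.Nat.Properties
  using (+-suc; +-identityʳ; *-identityʳ; *-zeroʳ; +-comm; *-comm; +-cancelˡ-≡; +-cancelʳ-≡;
         m+n≡0⇒m≡0; m+n≡0⇒n≡0; m*n≡0⇒m≡0∨n≡0; ≤-total; m≤n⇒∃[o]m+o≡n)
open import Data.Nat.DivMod using (m*n/n≡m)
open import Data.Nat.ListAction using (sum)
open import Data.Nat.Tactic.RingSolver using (solve-∀)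
import Data.Integer.Properties as ℤ
open import Data.Vec using (Vec; []; _∷_; lookup)
open import Data.List using (List; []; _∷_; _++_; map; concatMap; filter; length; allFin)
open import Data.List.Properties
  using (filter-++; length-++; filter-≐; filter-none; map-cong; length-tabulate)
import Data.List.Relation.Unary.All as All
open import Data.Sum using (inj₁; inj₂; reduce)
open import Data.Unit using (⊤; tt)
open import Function using (_∘_)
open import Relation.Nullary using (Dec; yes; no; ¬_; does; _×-dec_)
open import Relation.Unary using (Pred; Decidable)

module _ {p} {A : Set} {P : Pred A p} (P? : Decidable P) where

  length-filter-concatMap : ∀ {B : Set} (f : B → List A) xs →
    length (filter P? (concatMap f xs)) ≡ sum (map (length ∘ filter P? ∘ f) xs)
  length-filter-concatMap f []       = refl
  length-filter-concatMap f (x ∷ xs) = begin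
    length (filter P? (f x ++ concatMap f xs))             ≡⟨ cong length (filter-++ P? (f x) _) ⟩
    length (filter P? (f x) ++ filter P? (concatMap f xs)) ≡⟨ length-++ (filter P? (f x)) ⟩
    length (filter P? (f x)) + length (filter P? (concatMap f xs))
      ≡⟨ cong (λ n → length (filter P? (f x)) + n) (length-filter-concatMap f xs) ⟩
    sum (map (length ∘ filter P? ∘ f) (x ∷ xs))            ∎
    where open ≡-Reasoning

  length-filter-map : ∀ {B : Set} (f : B → A) xs →
    length (filter P? (map f xs)) ≡ length (filter (P? ∘ f) xs)
  length-filter-map f []       = refl
  length-filter-map f (x ∷ xs) with does (P? (f x))
  ... | true  = cong suc (length-filter-map f xs)
  ... | false = length-filter-map f xs

  length-filter-×-dec : ∀ {q} {Q : Set q} (Q? : Dec Q) xs →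
    length (filter (λ x → Q? ×-dec P? x) xs) ≡ (if does Q? then length (filter P? xs) else 0)
  length-filter-×-dec (yes q) xs = cong length (filter-≐ _ P? (proj₂ , (q ,_)) xs)
  length-filter-×-dec (no ¬q) xs = cong length (filter-none _ (All.universal (λ _ → ¬q ∘ proj₁) xs))

module _ {A : Set} (f : A → Cls) where

  classCount : Cls → List A → ℕ
  classCount c xs = length (filter (λ x → f x ≟C c) xs)

  sum-map-by-class : ∀ (F : Cls → ℕ) xs →
    sum (map (F ∘ f) xs) ≡
    classCount GEN xs * F GEN + classCount PROP xs * F PROP + classCount KILL xs * F KILL
  sum-map-by-class F []       = refl
  sum-map-by-class F (x ∷ xs) with f x | sum-map-by-class F xs
  ... | GEN  | ih = trans (cong (λ n → F GEN + n) ih)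
                          (add-GEN (classCount GEN xs) (classCount PROP xs) (classCount KILL xs) _ _ _)
    where add-GEN : ∀ g t k a b c → a + (g * a + t * b + k * c) ≡ suc g * a + t * b + k * c
          add-GEN = solve-∀
  ... | PROP | ih = trans (cong (λ n → F PROP + n) ih)
                          (add-PROP (classCount GEN xs) (classCount PROP xs) (classCount KILL xs) _ _ _)
    where add-PROP : ∀ g t k a b c → b + (g * a + t * b + k * c) ≡ g * a + suc t * b + k * c
          add-PROP = solve-∀
  ... | KILL | ih = trans (cong (λ n → F KILL + n) ih)
                          (add-KILL (classCount GEN xs) (classCount PROP xs) (classCount KILL xs) _ _ _)
    where add-KILL : ∀ g t k a b c → c + (g * a + t * b + k * c) ≡ g * a + t * b + suc k * c
          add-KILL = solve-∀

  length-by-class : ∀ xs → length xs ≡ classCount GEN xs + classCount PROP xs + classCount KILL xs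
  length-by-class []       = refl
  length-by-class (x ∷ xs) with f x | length-by-class xs
  ... | GEN  | ih = cong suc ih
  ... | PROP | ih = trans (cong suc ih)
                          (cong (_+ classCount KILL xs) (sym (+-suc (classCount GEN xs) _)))
  ... | KILL | ih = trans (cong suc ih) (sym (+-suc (classCount GEN xs + classCount PROP xs) _))

coupled-recurrent : ∀ g t k (u v : ℕ → ℕ) →
  (∀ L → u (suc L) ≡ g * v L + t * u L + k * u L) → (∀ L → v (suc L) ≡ g * v L + k * u L) →
  ℕ-Recurrence.Recurrent (g + t + k) (g * t) u
coupled-recurrent g t k u v u-suc v-suc L rewrite u-suc (suc L) | v-suc L | u-suc L =
  eliminate g t k (v L) (u L)
  where
  eliminate : ∀ g t k v u →
    g * (g * v + k * u) + t * (g * v + t * u + k * u) + k * (g * v + t * u + k * u) + g * t * u ≡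
    (g + t + k) * (g * v + t * u + k * u)
  eliminate = solve-∀

Allowed : State → Cls → Set
Allowed s c = c ≡ PROP → ¬ s ≡ oneS

-- By cases rather than via _≟_, so that continuations (below) computes on concrete s and c.
allowed? : ∀ s c → Dec (Allowed s c)
allowed? fzero        c    = yes λ _ ()
allowed? (fsuc fzero) GEN  = yes λ ()
allowed? (fsuc fzero) PROP = no λ allowed → allowed refl refl
allowed? (fsuc fzero) KILL = yes λ ()

module Cascades {N : ℕ} (cls : Fin N → Cls) where

  g t k : ℕ
  g = count cls GEN
  t = count cls PROP
  k = count cls KILL

  N≡g+t+k : N ≡ g + t + k
  N≡g+t+k = trans (sym (length-tabulate {n = N} (λ x → x))) (length-by-class cls (allFin N))

  CascadeFreeFrom : ∀ {L} → State → Vec (Fin N) L → Set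
  CascadeFreeFrom s []       = ⊤
  CascadeFreeFrom s (x ∷ xs) = Allowed s (cls x) × CascadeFreeFrom (T cls x s) xs

  cascadeFreeFrom? : ∀ {L} s (xs : Vec (Fin N) L) → Dec (CascadeFreeFrom s xs)
  cascadeFreeFrom? s []       = yes tt
  cascadeFreeFrom? s (x ∷ xs) = allowed? s (cls x) ×-dec cascadeFreeFrom? (T cls x s) xs

  cascadeFree⇔cascadeFreeFrom : ∀ {L} s (xs : Vec (Fin N) L) →
    (∀ j → Allowed (lookup (traj cls s xs) (inject₁ j)) (cls (lookup xs j))) ⇔ CascadeFreeFrom s xs
  cascadeFree⇔cascadeFreeFrom s []       = mk⇔ (λ _ → tt) (λ _ ())
  cascadeFree⇔cascadeFreeFrom s (x ∷ xs) = mk⇔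
    (λ cf → cf fzero , Equivalence.to rest (cf ∘ fsuc))
    λ where (ok , cf) fzero    → ok
            (ok , cf) (fsuc j) → Equivalence.from rest cf j
    where rest = cascadeFree⇔cascadeFreeFrom (T cls x s) xs

  countFrom : State → ℕ → ℕ
  countFrom s L = length (filter (cascadeFreeFrom? s) (allSeqs cls L))

  a≡countFrom : ∀ L → a cls L ≡ countFrom zeroS L
  a≡countFrom L = cong length (filter-≐ (cascadeFree? cls) (cascadeFreeFrom? zeroS)
    (Equivalence.to (cascadeFree⇔cascadeFreeFrom zeroS _) ,
     Equivalence.from (cascadeFree⇔cascadeFreeFrom zeroS _))
    (allSeqs cls L))

  continuations : State → Cls → ℕ → ℕ
  continuations s c L = if does (allowed? s c) then countFrom (Tcls c s) L else 0

  countFrom-suc : ∀ s L → countFrom s (suc L) ≡ sum (map (λ x → continuations s (cls x) L) (allFin N))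
  countFrom-suc s L = trans
    (length-filter-concatMap (cascadeFreeFrom? s) (λ x → map (x ∷_) (allSeqs cls L)) (allFin N))
    (cong sum (map-cong count-starting-with (allFin N)))
    where
    count-starting-with : ∀ x → length (filter (cascadeFreeFrom? s) (map (x ∷_) (allSeqs cls L))) ≡
                               continuations s (cls x) L
    count-starting-with x = trans
      (length-filter-map (cascadeFreeFrom? s) (x ∷_) (allSeqs cls L))
      (length-filter-×-dec (cascadeFreeFrom? (T cls x s)) (allowed? s (cls x)) (allSeqs cls L))

  countFrom-zeroS-suc : ∀ L →
    countFrom zeroS (suc L) ≡ g * countFrom oneS L + t * countFrom zeroS L + k * countFrom zeroS L
  countFrom-zeroS-suc L =
    trans (countFrom-suc zeroS L) (sum-map-by-class cls (λ c → continuations zeroS c L) (allFin N))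

  countFrom-oneS-suc : ∀ L → countFrom oneS (suc L) ≡ g * countFrom oneS L + k * countFrom zeroS L
  countFrom-oneS-suc L = begin
    countFrom oneS (suc L)                                    ≡⟨ countFrom-suc oneS L ⟩
    sum (map (λ x → continuations oneS (cls x) L) (allFin N))
      ≡⟨ sum-map-by-class cls (λ c → continuations oneS c L) (allFin N) ⟩
    g * countFrom oneS L + t * 0 + k * countFrom zeroS L
      ≡⟨ cong (λ n → g * countFrom oneS L + n + k * countFrom zeroS L) (*-zeroʳ t) ⟩
    g * countFrom oneS L + 0 + k * countFrom zeroS L          ≡⟨ cong (_+ k * countFrom zeroS L) (+-identityʳ _) ⟩
    g * countFrom oneS L + k * countFrom zeroS L              ∎
    where open ≡-Reasoning

  countFrom-recurrent : ℕ-Recurrence.Recurrent (g + t + k) (g * t) (countFrom zeroS)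
  countFrom-recurrent =
    coupled-recurrent g t k (countFrom zeroS) (countFrom oneS) countFrom-zeroS-suc countFrom-oneS-suc

  a-recurrent : ℕ-Recurrence.Recurrent N (g * t) (a cls)
  a-recurrent = ℕ-Recurrence.recurrent-cong (sym N≡g+t+k) (refl {x = g * t}) (λ L → sym (a≡countFrom L))
                                             countFrom-recurrent

  a₀ : a cls 0 ≡ 1
  a₀ = a≡countFrom 0

  a₁ : a cls 1 ≡ N
  a₁ = begin
    a cls 1                 ≡⟨ a≡countFrom 1 ⟩
    countFrom zeroS 1       ≡⟨ countFrom-zeroS-suc 0 ⟩
    g * 1 + t * 1 + k * 1   ≡⟨ cong₂ _+_ (cong₂ _+_ (*-identityʳ g) (*-identityʳ t)) (*-identityʳ k) ⟩
    g + t + k               ≡⟨ N≡g+t+k ⟨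
    N                       ∎
    where open ≡-Reasoning

m*m≡0⇒m≡0 : ∀ m → m * m ≡ 0 → m ≡ 0
m*m≡0⇒m≡0 m eq = reduce (m*n≡0⇒m≡0∨n≡0 m eq)

m≤n⇒[m+n+o]²≡4mn⇒m≡n×o≡0 : ∀ {m n} o → m ≤ n → (m + n + o) * (m + n + o) ≡ 4 * (m * n) → m ≡ n × o ≡ 0
m≤n⇒[m+n+o]²≡4mn⇒m≡n×o≡0 {m} o m≤n eq with e , refl ← m≤n⇒∃[o]m+o≡n m≤n =
  sym (trans (cong (λ n → m + n) e≡0) (+-identityʳ m)) , o≡0
  where
  expand : ∀ m e o → (m + (m + e) + o) * (m + (m + e) + o) ≡
                     4 * (m * (m + e)) + (e * e + (o * o + (4 * m * o + 2 * e * o)))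
  expand = solve-∀
  excess≡0 : e * e + (o * o + (4 * m * o + 2 * e * o)) ≡ 0
  excess≡0 = +-cancelˡ-≡ (4 * (m * (m + e))) _ _
               (trans (sym (expand m e o)) (trans eq (sym (+-identityʳ _))))
  e≡0 : e ≡ 0
  e≡0 = m*m≡0⇒m≡0 e (m+n≡0⇒m≡0 (e * e) excess≡0)
  o≡0 : o ≡ 0
  o≡0 = m*m≡0⇒m≡0 o (m+n≡0⇒m≡0 (o * o) (m+n≡0⇒n≡0 (e * e) excess≡0))

[m+n+o]²≡4mn⇒m≡n×o≡0 : ∀ m n o → (m + n + o) * (m + n + o) ≡ 4 * (m * n) → m ≡ n × o ≡ 0
[m+n+o]²≡4mn⇒m≡n×o≡0 m n o eq with ≤-total m n
... | inj₁ m≤n = m≤n⇒[m+n+o]²≡4mn⇒m≡n×o≡0 o m≤n eq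
... | inj₂ n≤m =
  let swapped = subst₂ (λ s p → s * s ≡ 4 * p) (cong (_+ o) (+-comm m n)) (*-comm m n) eq
      n≡m , o≡0 = m≤n⇒[m+n+o]²≡4mn⇒m≡n×o≡0 o n≤m swapped
  in sym n≡m , o≡0

m≡[m+m+0]/2 : ∀ m → m ≡ (m + m + 0) / 2
m≡[m+m+0]/2 m = sym (trans (cong (_/ 2) (double m)) (m*n/n≡m m 2))
  where
  double : ∀ m → m + m + 0 ≡ m * 2
  double = solve-∀

[g+t+k]²≡4gt⇔k≡0×g≡t≡half : ∀ {n} g t k → n ≡ g + t + k →
  (n * n ≡ 4 * (g * t)) ⇔ (k ≡ 0 × g ≡ n / 2 × t ≡ n / 2)
[g+t+k]²≡4gt⇔k≡0×g≡t≡half g t k refl = mk⇔ (balanced g t k) (square g t k)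
  where
  balanced : ∀ g t k → (g + t + k) * (g + t + k) ≡ 4 * (g * t) →
             k ≡ 0 × g ≡ (g + t + k) / 2 × t ≡ (g + t + k) / 2
  balanced g t k eq with refl , refl ← [m+n+o]²≡4mn⇒m≡n×o≡0 g t k eq =
    refl , m≡[m+m+0]/2 g , m≡[m+m+0]/2 g
  square : ∀ g t k → k ≡ 0 × g ≡ (g + t + k) / 2 × t ≡ (g + t + k) / 2 →
           (g + t + k) * (g + t + k) ≡ 4 * (g * t)
  square g t .0 (refl , g≡half , t≡half) with refl ← trans g≡half (sym t≡half) = [g+g+0]²≡4gg g
    where
    [g+g+0]²≡4gg : ∀ g → (g + g + 0) * (g + g + 0) ≡ 4 * (g * g)
    [g+g+0]²≡4gg = solve-∀

double-root-solution : ∀ h {A : ℕ → ℕ} → A 0 ≡ 1 → A 1 ≡ h + h →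
  ℕ-Recurrence.Recurrent (h + h) (h * h) A → ∀ L → A L ≡ suc L * h ^ L
double-root-solution h A₀ A₁ rec =
  ℕ-Recurrence.recurrent-unique {h + h} {h * h} +-cancelʳ-≡ rec closed-form-recurrent
                                A₀ (trans A₁ (double h))
  where
  double : ∀ h → h + h ≡ 2 * (h * 1)
  double = solve-∀
  shift : ∀ L h p → suc (suc (suc L)) * (h * (h * p)) + h * h * (suc L * p) ≡
                    (h + h) * (suc (suc L) * (h * p))
  shift = solve-∀
  closed-form-recurrent : ℕ-Recurrence.Recurrent (h + h) (h * h) (λ L → suc L * h ^ L)
  closed-form-recurrent L = shift L h (h ^ L)

m+n≡p⇒+m≡+p-+n : ∀ {m n p} → m + n ≡ p → + m ≡ + p -ℤ + n
m+n≡p⇒+m≡+p-+n {m} {n} refl = sym (trans (cong (_-ℤ + n) (ℤ.pos-+ m n)) (//-rightDividesʳ (+ n) (+ m)))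
  where open GroupProperties (CommutativeRing.+-group ℤ.+-*-commutativeRing) using (//-rightDividesʳ)

theorem3p5 : (N : ℕ) (cls : Fin N → Cls) →
    let g = count cls GEN
        t = count cls PROP
        k = count cls KILL
        d = g * t
        A = a cls
    in
    -- recurrence and initial values
    (∀ L → + A (suc (suc L)) ≡ (+ N *ℤ + A (suc L)) -ℤ (+ d *ℤ + A L))
    × A 0 ≡ 1
    × A 1 ≡ N
    -- Case 1 (stated in any commutative ring containing the two roots
    -- λ₁, λ₂ of x² - N x + d, with the division cleared)
    × (N * N > 4 * d →
        (R : CommutativeRing 0ℓ 0ℓ) → BinetForm R N d A)
    -- Case 2
    × ((N * N ≡ 4 * d) ⇔ (k ≡ 0 × g ≡ N / 2 × t ≡ N / 2))
    × (N * N ≡ 4 * d → ∀ L → A L ≡ suc L * (N / 2) ^ L)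
theorem3p5 N cls = integer-recurrence , a₀ , a₁ , binet-form , discriminant , double-root
  where
  open Cascades cls

  integer-recurrence : ∀ L → + a cls (suc (suc L)) ≡ (+ N *ℤ + a cls (suc L)) -ℤ (+ (g * t) *ℤ + a cls L)
  integer-recurrence L =
    trans (m+n≡p⇒+m≡+p-+n (a-recurrent L)) (cong₂ _-ℤ_ (ℤ.pos-* N _) (ℤ.pos-* (g * t) _))

  -- The cleared identity holds for any two roots; N² > 4gt only makes them distinct and real.
  binet-form : N * N > 4 * (g * t) → (R : CommutativeRing 0ℓ 0ℓ) → BinetForm R N (g * t) (a cls)
  binet-form _ R = binet R N (g * t) (a cls) a₀ a₁ a-recurrent

  discriminant : (N * N ≡ 4 * (g * t)) ⇔ (k ≡ 0 × g ≡ N / 2 × t ≡ N / 2)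
  discriminant = [g+t+k]²≡4gt⇔k≡0×g≡t≡half g t k N≡g+t+k

  double-root : N * N ≡ 4 * (g * t) → ∀ L → a cls L ≡ suc L * (N / 2) ^ L
  double-root N²≡4gt =
    let k≡0 , g≡h , t≡h = Equivalence.to discriminant N²≡4gt
        N≡h+h = trans N≡g+t+k (trans (cong₂ _+_ (cong₂ _+_ g≡h t≡h) k≡0) (+-identityʳ (N / 2 + N / 2)))
    in double-root-solution (N / 2) a₀ (trans a₁ N≡h+h)
         (ℕ-Recurrence.recurrent-cong N≡h+h (cong₂ _*_ g≡h t≡h) (λ _ → refl) a-recurrent)
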